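{- Let $M$ be a matroid on $[n]=\{1,\dots,n\}$ (with the natural order) and let $B$ be a basis of $M$. If $v\in B$ is not internally active with respect to $B$ in $M$, then $\mathrm{int}_M(B)=\mathrm{int}_{M/v}(B-\{v\})$ and $\mathrm{ext}_M(B)\le \mathrm{ext}_{M/v}(B-\{v\})$. Dually, if $v\in[n]-B$ is not externally active with respect to $B$ in $M$, then $\mathrm{int}_M(B)\le \mathrm{int}_{M-v}(B)$ and $\mathrm{ext}_M(B)=\mathrm{ext}_{M-v}(B)$.
   Context: For a matroid $M$ on a totally ordered ground set $E$ and a basis $B$: an element $v\in B$ is internally active with respect to $B$ if $v$ is the smallest element of the fundamental cocircuit $C^*(v,B)$, the unique cocircuit contained in $(E-B)\cup\{v\}$; an element $v\in E-B$ is externally active with respect to $B$ if $v$ is the smallest element of the fundamental circuit $C(v,B)$, the unique circuit contained in $B\cup\{v\}$. $\mathrm{int}_M(B)$ and $\mathrm{ext}_M(B)$ denote the numbers of internally and externally active elements. Activities in the minors $M/v$ and $M-v$ are computed with respect to the order restricted to $[n]-\{v\}$. -}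

module Defs where

open import Data.Bool using (Bool; true; false; _∧_; _∨_; not; if_then_else_)
open import Data.Nat using (ℕ; zero; suc; _+_; _<_; _≤ᵇ_)
open import Data.Fin using (Fin; toℕ)
open import Data.Fin.Subset using (Subset; _∈_; _∉_; _⊆_; _∪_; ⁅_⁆; ∣_∣; ⊥)
open import Data.Vec using (Vec; []; _∷_; lookup; zipWith; insertAt; removeAt; replicate)
open import Data.List using (List; []; _∷_; map; _++_)
open import Data.Bool.ListAction using (all; any)
open import Data.List using () renaming ([_] to L[_])
open import Data.Product using (Σ; _×_; ∃-syntax)
open import Relation.Binary.PropositionalEquality using (_≡_)

-- Boolean (computable) operations on subsets of Fin n (= Vec Bool n).
-- Ground set [n] is modelled by Fin n, ordered by toℕ (i ↦ i+1 is an
-- order isomorphism onto {1,…,n}).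

allFinL : ∀ n → List (Fin n)
allFinL zero = []
allFinL (suc n) = Data.Fin.zero ∷ map Data.Fin.suc (allFinL n)

allSubsets : ∀ n → List (Subset n)
allSubsets zero = L[ [] ]
allSubsets (suc n) = map (false ∷_) (allSubsets n) ++ map (true ∷_) (allSubsets n)

andV : ∀ {n} → Vec Bool n → Bool
andV [] = true
andV (b ∷ bs) = b ∧ andV bs

orV : ∀ {n} → Vec Bool n → Bool
orV [] = false
orV (b ∷ bs) = b ∨ orV bs

_⊆ᵇ_ : ∀ {n} → Subset n → Subset n → Bool
A ⊆ᵇ B = andV (zipWith (λ a b → not a ∨ b) A B)

_=ᵇ_ : ∀ {n} → Subset n → Subset n → Bool
A =ᵇ B = A ⊆ᵇ B ∧ B ⊆ᵇ A

meetsᵇ : ∀ {n} → Subset n → Subset n → Bool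
meetsᵇ A B = orV (zipWith _∧_ A B)

complement : ∀ {n} → Subset n → Subset n
complement [] = []
complement (b ∷ bs) = not b ∷ complement bs

countᵇ : ∀ {A : Set} → (A → Bool) → List A → ℕ
countᵇ p [] = 0
countᵇ p (x ∷ xs) = (if p x then 1 else 0) + countᵇ p xs

Oracle : ℕ → Set
Oracle n = Subset n → Bool

record Matroid (n : ℕ) : Set where
  field
    indep : Oracle n
    indep-empty : indep ⊥ ≡ true
    indep-hereditary : ∀ (A B : Subset n) → A ⊆ B → indep B ≡ true → indep A ≡ true
    indep-augment : ∀ (A B : Subset n) → indep A ≡ true → indep B ≡ true → ∣ A ∣ < ∣ B ∣ →
      ∃[ e ] (e ∈ B × e ∉ A × indep (A ∪ ⁅ e ⁆) ≡ true)

-- Notions defined for an arbitrary independence oracle (so that they can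
-- be applied to minors without re-proving the matroid axioms).

module _ {n : ℕ} (I : Oracle n) where

  isBasis : Subset n → Bool
  isBasis B = I B ∧ all (λ A → not (B ⊆ᵇ A ∧ I A) ∨ (A =ᵇ B)) (allSubsets n)

  isCircuit : Subset n → Bool
  isCircuit C = not (I C) ∧ all (λ D → not (D ⊆ᵇ C ∧ not (D =ᵇ C)) ∨ I D) (allSubsets n)

  dual : Oracle n
  dual A = any (λ B → isBasis B ∧ not (meetsᵇ A B)) (allSubsets n)

isCocircuit : ∀ {n} → Oracle n → Subset n → Bool
isCocircuit I = isCircuit (dual I)

isMinOf : ∀ {n} → Fin n → Subset n → Bool
isMinOf {n} v D = lookup D v ∧ all (λ e → not (lookup D e) ∨ (toℕ v ≤ᵇ toℕ e)) (allFinL n)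

module _ {n : ℕ} (I : Oracle n) (B : Subset n) where

  -- v ∈ B is internally active: v is the smallest element of the
  -- fundamental cocircuit C*(v,B), the unique cocircuit contained in
  -- (E - B) ∪ {v}.
  intActive : Fin n → Bool
  intActive v = lookup B v ∧
    any (λ D → isCocircuit I D ∧ (D ⊆ᵇ (complement B ∪ ⁅ v ⁆)) ∧ lookup D v ∧ isMinOf v D)
        (allSubsets n)

  -- v ∉ B is externally active: v is the smallest element of the
  -- fundamental circuit C(v,B), the unique circuit contained in B ∪ {v}.
  extActive : Fin n → Bool
  extActive v = not (lookup B v) ∧
    any (λ C → isCircuit I C ∧ (C ⊆ᵇ (B ∪ ⁅ v ⁆)) ∧ lookup C v ∧ isMinOf v C)
        (allSubsets n)

  int : ℕ
  int = countᵇ intActive (allFinL n)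

  ext : ℕ
  ext = countᵇ extActive (allFinL n)

-- For v : Fin (suc m), the ground set [n] - {v} is identified
-- with Fin m via insertAt/removeAt at position v (punchIn), which is
-- order preserving, so the natural order on Fin m is the restricted order.

lift : ∀ {m} → Fin (suc m) → Subset m → Subset (suc m)
lift v A = insertAt A v false

restrict : ∀ {m} → Fin (suc m) → Subset (suc m) → Subset m
restrict v A = removeAt A v

deleteO : ∀ {m} → Oracle (suc m) → Fin (suc m) → Oracle m
deleteO I v A = I (lift v A)

-- contraction M / v  (if v is a loop, M / v = M - v)
contractO : ∀ {m} → Oracle (suc m) → Fin (suc m) → Oracle m
contractO I v A = if I ⁅ v ⁆ then I (lift v A ∪ ⁅ v ⁆) else I (lift v A)

-- Identify [n] - {v} with Fin m through punchIn v; then activities in the minor can be compared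
-- element by element with those in M, and v itself contributes nothing since it is not active.
-- Circuits of M - v are the circuits of M avoiding v, and, as (M / v)* = M* - v, cocircuits of
-- M / v are the cocircuits of M avoiding v. So the fundamental circuits of M - v and the
-- fundamental cocircuits of M / v are those of M, which gives the two equalities. For the
-- inequalities: if v ∈ B, the fundamental circuit C(e, B) with v removed is still a circuit of
-- M / v (each proper subset becomes independent by basis exchange), so an externally active e
-- stays externally active; dually, if v ∉ B, C*(e, B) with v removed is a cocircuit of M - v.
module Submission where

open import Defs
open import Data.Nat using (ℕ; zero; suc; _≤_; _<_; _+_; z≤n; s≤s)
import Data.Nat.Properties as ℕ
open import Algebra.Properties.CommutativeSemigroup ℕ.+-commutativeSemigroup using (x∙yz≈y∙xz)
open import Data.Fin as Fin using (Fin; toℕ; punchIn; punchOut)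
import Data.Fin.Properties as Fin
open import Data.Fin.Subset using (Subset; _∈_; _∉_; _⊆_; _⊂_; _∪_; _─_; ⁅_⁆; ∣_∣; _-_; ∁)
open import Data.Fin.Subset.Properties as Sub using (_∈?_)
open import Data.Vec using ([]; _∷_; lookup; insertAt; removeAt; here; there)
import Data.Vec.Properties as Vec
open import Data.List as List using (List)
open import Data.List.Membership.Propositional using (lose) renaming (_∈_ to _∈ˡ_)
open import Data.List.Membership.Propositional.Properties using (∈-map⁺; ∈-++⁺ˡ; ∈-++⁺ʳ)
import Data.List.Relation.Unary.All as All
import Data.List.Relation.Unary.Any as Any
open import Data.List.Relation.Unary.All.Properties using (all⁺; all⁻)
open import Data.List.Relation.Unary.Any.Properties using (any⁺; any⁻)
open import Data.Bool using (Bool; true; false; _∧_; _∨_; not; if_then_else_; _≟_)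
open import Data.Bool.Properties using (T-≡; ¬-not; ⇔→≡; ∧-conicalˡ; ∧-conicalʳ; not-involutive)
open import Data.Bool.ListAction using (all; any)
open import Data.Product using (_×_; _,_; proj₁; proj₂; ∃-syntax; map₂)
open import Data.Sum using (inj₁; inj₂)
open import Data.Empty using (⊥; ⊥-elim)
open import Relation.Nullary using (¬_; yes; no; _→-dec_)
open import Relation.Binary.PropositionalEquality
  using (_≡_; _≢_; refl; sym; trans; cong; cong₂; subst; module ≡-Reasoning)
open import Function using (_∘_; mk⇔; Equivalence)

private
  variable
    n : ℕ

-- Boolean reflection

∧-true⁻ : ∀ a {b} → a ∧ b ≡ true → a ≡ true × b ≡ true
∧-true⁻ a h = ∧-conicalˡ a _ h , ∧-conicalʳ a _ h

∧-true⁺ : ∀ {a b} → a ≡ true → b ≡ true → a ∧ b ≡ true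
∧-true⁺ refl refl = refl

not-true⁻ : ∀ {a} → not a ≡ true → a ≡ false
not-true⁻ {a} h = trans (sym (not-involutive a)) (cong not h)

not∨⁺ : ∀ {a b} → (a ≡ true → b ≡ true) → not a ∨ b ≡ true
not∨⁺ {false} _ = refl
not∨⁺ {true}  f = f refl

not∨⁻ : ∀ {a b} → not a ∨ b ≡ true → a ≡ true → b ≡ true
not∨⁻ h refl = h

true≢false : ∀ {a} → a ≡ true → a ≡ false → ⊥
true≢false refl ()

Exhaustive : {A : Set} → List A → Set
Exhaustive xs = ∀ x → x ∈ˡ xs

allFinL-exhaustive : ∀ n → Exhaustive (allFinL n)
allFinL-exhaustive (suc n) Fin.zero    = Any.here refl
allFinL-exhaustive (suc n) (Fin.suc i) = Any.there (∈-map⁺ Fin.suc (allFinL-exhaustive n i))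

allSubsets-exhaustive : ∀ n → Exhaustive (allSubsets n)
allSubsets-exhaustive zero    []          = Any.here refl
allSubsets-exhaustive (suc n) (false ∷ A) = ∈-++⁺ˡ (∈-map⁺ (false ∷_) (allSubsets-exhaustive n A))
allSubsets-exhaustive (suc n) (true ∷ A)  =
  ∈-++⁺ʳ (List.map (false ∷_) (allSubsets n)) (∈-map⁺ (true ∷_) (allSubsets-exhaustive n A))

module _ {A : Set} {xs : List A} (exhaustive : Exhaustive xs) (p : A → Bool) where

  all-exhaustive⁻ : all p xs ≡ true → ∀ x → p x ≡ true
  all-exhaustive⁻ h x =
    Equivalence.to T-≡ (All.lookup (all⁺ p xs (Equivalence.from T-≡ h)) (exhaustive x))

  all-exhaustive⁺ : (∀ x → p x ≡ true) → all p xs ≡ true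
  all-exhaustive⁺ h = Equivalence.to T-≡ (all⁻ p {xs} (All.tabulate λ {x} _ → Equivalence.from T-≡ (h x)))

  any-exhaustive⁻ : any p xs ≡ true → ∃[ x ] p x ≡ true
  any-exhaustive⁻ h = map₂ (Equivalence.to T-≡) (Any.satisfied (any⁻ p xs (Equivalence.from T-≡ h)))

  any-exhaustive⁺ : ∀ x → p x ≡ true → any p xs ≡ true
  any-exhaustive⁺ x h = Equivalence.to T-≡ (any⁺ p (lose (exhaustive x) (Equivalence.from T-≡ h)))

∈⇒lookup : ∀ {A : Subset n} {x} → x ∈ A → lookup A x ≡ true
∈⇒lookup = Vec.[]=⇒lookup

lookup⇒∈ : ∀ {A : Subset n} {x} → lookup A x ≡ true → x ∈ A
lookup⇒∈ {A = A} {x} = Vec.lookup⇒[]= x A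

∉⇒lookup : ∀ {A : Subset n} {x} → x ∉ A → lookup A x ≡ false
∉⇒lookup x∉A = ¬-not (x∉A ∘ lookup⇒∈)

⊆ᵇ⁻ : ∀ (A B : Subset n) → A ⊆ᵇ B ≡ true → A ⊆ B
⊆ᵇ⁻ (true ∷ A) (true ∷ B)  h here      = here
⊆ᵇ⁻ (true ∷ A) (false ∷ B) () here
⊆ᵇ⁻ (a ∷ A)    (b ∷ B)     h (there p) = there (⊆ᵇ⁻ A B (proj₂ (∧-true⁻ (not a ∨ b) h)) p)

⊆ᵇ⁺ : ∀ {A B : Subset n} → A ⊆ B → A ⊆ᵇ B ≡ true
⊆ᵇ⁺ {A = []}        {[]}    A⊆B = refl
⊆ᵇ⁺ {A = false ∷ A} {b ∷ B} A⊆B = ⊆ᵇ⁺ (Sub.drop-∷-⊆ A⊆B)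
⊆ᵇ⁺ {A = true ∷ A}  {b ∷ B} A⊆B = ∧-true⁺ (∈⇒lookup {A = b ∷ B} (A⊆B here)) (⊆ᵇ⁺ (Sub.drop-∷-⊆ A⊆B))

=ᵇ⁻ : ∀ (A B : Subset n) → A =ᵇ B ≡ true → A ≡ B
=ᵇ⁻ A B h = let A⊆B , B⊆A = ∧-true⁻ (A ⊆ᵇ B) h in Sub.⊆-antisym (⊆ᵇ⁻ A B A⊆B) (⊆ᵇ⁻ B A B⊆A)

=ᵇ⁺ : ∀ {A B : Subset n} → A ≡ B → A =ᵇ B ≡ true
=ᵇ⁺ {A = A} refl = ∧-true⁺ (⊆ᵇ⁺ {A = A} Sub.⊆-refl) (⊆ᵇ⁺ {A = A} Sub.⊆-refl)

=ᵇ-≢ : ∀ {A B : Subset n} → A ≢ B → A =ᵇ B ≡ false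
=ᵇ-≢ {A = A} {B} A≢B = ¬-not (A≢B ∘ =ᵇ⁻ A B)

Disjoint : Subset n → Subset n → Set
Disjoint A B = ∀ {x} → x ∈ A → x ∉ B

meetsᵇ-false⁻ : ∀ (A B : Subset n) → meetsᵇ A B ≡ false → Disjoint A B
meetsᵇ-false⁻ (true ∷ A) (true ∷ B) () here here
meetsᵇ-false⁻ (a ∷ A)    (b ∷ B)    h (there p) (there q) with a ∧ b
... | false = meetsᵇ-false⁻ A B h p q

meetsᵇ-false⁺ : ∀ (A B : Subset n) → Disjoint A B → meetsᵇ A B ≡ false
meetsᵇ-false⁺ []          []          _ = refl
meetsᵇ-false⁺ (true ∷ A)  (true ∷ B)  d = ⊥-elim (d here here)
meetsᵇ-false⁺ (false ∷ A) (b ∷ B)     d = meetsᵇ-false⁺ A B (λ p q → d (there p) (there q))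
meetsᵇ-false⁺ (true ∷ A)  (false ∷ B) d = meetsᵇ-false⁺ A B (λ p q → d (there p) (there q))

complement≡∁ : ∀ (A : Subset n) → complement A ≡ ∁ A
complement≡∁ []      = refl
complement≡∁ (a ∷ A) = cong (not a ∷_) (complement≡∁ A)

∈complement⁻ : ∀ {A : Subset n} {x} → x ∈ complement A → x ∉ A
∈complement⁻ {A = A} p = Sub.x∈∁p⇒x∉p (subst (_ ∈_) (complement≡∁ A) p)

∈complement⁺ : ∀ {A : Subset n} {x} → x ∉ A → x ∈ complement A
∈complement⁺ {A = A} x∉A = subst (_ ∈_) (sym (complement≡∁ A)) (Sub.x∉p⇒x∈∁p x∉A)

⊆∧≢⇒⊂ : ∀ {X C : Subset n} → X ⊆ C → X ≢ C → X ⊂ C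
⊆∧≢⇒⊂ {n} {X} {C} X⊆C X≢C
  with Fin.¬∀⟶∃¬ n (λ y → y ∈ C → y ∈ X) (λ y → y ∈? C →-dec y ∈? X)
         (λ C⊆X → X≢C (Sub.⊆-antisym X⊆C (C⊆X _)))
... | y , C⇏X with y ∈? C
...   | yes y∈C = X⊆C , y , y∈C , λ y∈X → C⇏X (λ _ → y∈X)
...   | no  y∉C = ⊥-elim (C⇏X (⊥-elim ∘ y∉C))

∣p∪⁅x⁆∣≤1+∣p∣ : ∀ (p : Subset n) x → ∣ p ∪ ⁅ x ⁆ ∣ ≤ suc ∣ p ∣
∣p∪⁅x⁆∣≤1+∣p∣ (false ∷ p) Fin.zero    rewrite Sub.∪-identityʳ p = ℕ.≤-refl
∣p∪⁅x⁆∣≤1+∣p∣ (true ∷ p)  Fin.zero    rewrite Sub.∪-identityʳ p = ℕ.n≤1+n _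
∣p∪⁅x⁆∣≤1+∣p∣ (true ∷ p)  (Fin.suc x) = s≤s (∣p∪⁅x⁆∣≤1+∣p∣ p x)
∣p∪⁅x⁆∣≤1+∣p∣ (false ∷ p) (Fin.suc x) = ∣p∪⁅x⁆∣≤1+∣p∣ p x

∣p∣<∣p∪⁅x⁆∣ : ∀ (p : Subset n) {x} → x ∉ p → ∣ p ∣ < ∣ p ∪ ⁅ x ⁆ ∣
∣p∣<∣p∪⁅x⁆∣ p {x} x∉p = Sub.p⊂q⇒∣p∣<∣q∣ (Sub.p⊆p∪q ⁅ x ⁆ , x , Sub.q⊆p∪q p _ (Sub.x∈⁅x⁆ x) , x∉p)

p-x∪⁅x⁆≡p : ∀ {p : Subset n} {x} → x ∈ p → (p - x) ∪ ⁅ x ⁆ ≡ p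
p-x∪⁅x⁆≡p {p = p} {x} x∈p = Sub.⊆-antisym ⊆p p⊆
  where
  ⊆p : (p - x) ∪ ⁅ x ⁆ ⊆ p
  ⊆p q with Sub.x∈p∪q⁻ (p - x) ⁅ x ⁆ q
  ... | inj₁ r = Sub.p─q⊆p p ⁅ x ⁆ r
  ... | inj₂ r rewrite Sub.x∈⁅y⁆⇒x≡y x r = x∈p
  p⊆ : p ⊆ (p - x) ∪ ⁅ x ⁆
  p⊆ {y} y∈p with y Fin.≟ x
  ... | yes refl = Sub.q⊆p∪q (p - x) _ (Sub.x∈⁅x⁆ x)
  ... | no  y≢x  = Sub.p⊆p∪q ⁅ x ⁆ (Sub.x∈p∧x≢y⇒x∈p-y y∈p y≢x)

∣p∣≤1+∣p-x∣ : ∀ {p : Subset n} {x} → x ∈ p → ∣ p ∣ ≤ suc ∣ p - x ∣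
∣p∣≤1+∣p-x∣ {p = p} {x} x∈p = subst (λ q → ∣ q ∣ ≤ suc ∣ p - x ∣) (p-x∪⁅x⁆≡p x∈p) (∣p∪⁅x⁆∣≤1+∣p∣ (p - x) x)

p⊆q∧∣q∣≤∣p∣⇒q⊆p : ∀ {p q : Subset n} → p ⊆ q → ∣ q ∣ ≤ ∣ p ∣ → q ⊆ p
p⊆q∧∣q∣≤∣p∣⇒q⊆p {p = p} p⊆q q≤p {x} x∈q with x ∈? p
... | yes x∈p = x∈p
... | no  x∉p = ⊥-elim (ℕ.<⇒≱ (Sub.p⊂q⇒∣p∣<∣q∣ (p⊆q , x , x∈q , x∉p)) q≤p)

x∈p─q⇒x∉q : ∀ (p q : Subset n) {x} → x ∈ p ─ q → x ∉ q
x∈p─q⇒x∉q (s ∷ p)    (true ∷ q)  ()        here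
x∈p─q⇒x∉q (true ∷ p) (false ∷ q) here      ()
x∈p─q⇒x∉q (s ∷ p)    (t ∷ q)     (there a) (there b) = x∈p─q⇒x∉q p q a b

x∈p-y⁻ : ∀ {p : Subset n} {y x} → x ∈ p - y → x ∈ p × x ≢ y
x∈p-y⁻ {p = p} {y} x∈p-y = Sub.p─q⊆p p ⁅ y ⁆ x∈p-y , λ { refl → x∈p─q⇒x∉q p ⁅ y ⁆ x∈p-y (Sub.x∈⁅x⁆ y) }

module _ (J : Oracle n) where

  record IsCircuit (C : Subset n) : Set where
    field
      dependent : J C ≡ false
      minimal   : ∀ X → X ⊆ C → X ≢ C → J X ≡ true

  record IsBasis (B : Subset n) : Set where
    field
      independent : J B ≡ true
      maximal     : ∀ A → B ⊆ A → J A ≡ true → A ≡ B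

  isCircuit⁻ : ∀ {C} → isCircuit J C ≡ true → IsCircuit C
  isCircuit⁻ {C} h = record
    { dependent = not-true⁻ dependent
    ; minimal   = λ X X⊆C X≢C → not∨⁻ (all-exhaustive⁻ (allSubsets-exhaustive n) _ minimal X)
                                       (∧-true⁺ (⊆ᵇ⁺ X⊆C) (cong not (=ᵇ-≢ X≢C)))
    }
    where
    dependent = proj₁ (∧-true⁻ (not (J C)) h)
    minimal   = proj₂ (∧-true⁻ (not (J C)) h)

  isCircuit⁺ : ∀ {C} → IsCircuit C → isCircuit J C ≡ true
  isCircuit⁺ {C} c = ∧-true⁺ (cong not (IsCircuit.dependent c))
    (all-exhaustive⁺ (allSubsets-exhaustive n) _ λ X → not∨⁺ λ h →
      let X⊆C , X≠C = ∧-true⁻ (X ⊆ᵇ C) h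
      in IsCircuit.minimal c X (⊆ᵇ⁻ X C X⊆C) λ X≡C → true≢false (=ᵇ⁺ X≡C) (not-true⁻ X≠C))

  isBasis⁻ : ∀ {B} → isBasis J B ≡ true → IsBasis B
  isBasis⁻ {B} h = record
    { independent = independent
    ; maximal     = λ A B⊆A indA → =ᵇ⁻ A B (not∨⁻ (all-exhaustive⁻ (allSubsets-exhaustive n) _ maximal A)
                                                 (∧-true⁺ (⊆ᵇ⁺ B⊆A) indA))
    }
    where
    independent = proj₁ (∧-true⁻ (J B) h)
    maximal     = proj₂ (∧-true⁻ (J B) h)

  isBasis⁺ : ∀ {B} → IsBasis B → isBasis J B ≡ true
  isBasis⁺ {B} b = ∧-true⁺ (IsBasis.independent b)
    (all-exhaustive⁺ (allSubsets-exhaustive n) _ λ A → not∨⁺ λ h →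
      let B⊆A , indA = ∧-true⁻ (B ⊆ᵇ A) h
      in =ᵇ⁺ (IsBasis.maximal b A (⊆ᵇ⁻ B A B⊆A) indA))

  dual⁻ : ∀ {A} → dual J A ≡ true → ∃[ W ] (IsBasis W × Disjoint A W)
  dual⁻ {A} h with any-exhaustive⁻ (allSubsets-exhaustive n) _ h
  ... | W , r = let b , m = ∧-true⁻ (isBasis J W) r
                in W , isBasis⁻ b , meetsᵇ-false⁻ A W (not-true⁻ m)

  dual⁺ : ∀ {A W} → IsBasis W → Disjoint A W → dual J A ≡ true
  dual⁺ {A} {W} b d = any-exhaustive⁺ (allSubsets-exhaustive n) _ W
    (∧-true⁺ (isBasis⁺ b) (cong not (meetsᵇ-false⁺ A W d)))

IsLeast : Fin n → Subset n → Set
IsLeast v D = v ∈ D × (∀ e → e ∈ D → toℕ v ≤ toℕ e)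

isMinOf⁻ : ∀ {v : Fin n} {D} → isMinOf v D ≡ true → IsLeast v D
isMinOf⁻ {n} {v} {D} h = lookup⇒∈ v∈D , least
  where
  v∈D   = proj₁ (∧-true⁻ (lookup D v) h)
  least : ∀ e → e ∈ D → toℕ v ≤ toℕ e
  least e e∈D = ℕ.≤ᵇ⇒≤ (toℕ v) (toℕ e) (Equivalence.from T-≡
    (not∨⁻ (all-exhaustive⁻ (allFinL-exhaustive n) _ (proj₂ (∧-true⁻ (lookup D v) h)) e) (∈⇒lookup e∈D)))

isMinOf⁺ : ∀ {v : Fin n} {D} → IsLeast v D → isMinOf v D ≡ true
isMinOf⁺ {n} {v} {D} (v∈D , least) = ∧-true⁺ (∈⇒lookup v∈D)
  (all-exhaustive⁺ (allFinL-exhaustive n) _ λ e → not∨⁺ λ e∈D →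
    Equivalence.to T-≡ (ℕ.≤⇒≤ᵇ (least e (lookup⇒∈ e∈D))))

-- intActive I B v unfolds to lookup B v ∧ leastInCircuitWithin (dual I) (complement B ∪ ⁅ v ⁆) v,
-- and extActive I B v to not (lookup B v) ∧ leastInCircuitWithin I (B ∪ ⁅ v ⁆) v.
leastInCircuitWithin : Oracle n → Subset n → Fin n → Bool
leastInCircuitWithin {n} J S v =
  any (λ C → isCircuit J C ∧ (C ⊆ᵇ S) ∧ lookup C v ∧ isMinOf v C) (allSubsets n)

LeastInCircuitWithin : Oracle n → Subset n → Fin n → Set
LeastInCircuitWithin J S v = ∃[ C ] (IsCircuit J C × C ⊆ S × IsLeast v C)

leastInCircuitWithin⁻ : ∀ {J : Oracle n} {S v} →
  leastInCircuitWithin J S v ≡ true → LeastInCircuitWithin J S v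
leastInCircuitWithin⁻ {n} {J} {S} {v} h with any-exhaustive⁻ (allSubsets-exhaustive n) _ h
... | C , r = let c , r′ = ∧-true⁻ (isCircuit J C) r
                  s , r″ = ∧-true⁻ (C ⊆ᵇ S) r′
              in C , isCircuit⁻ J c , ⊆ᵇ⁻ C S s , isMinOf⁻ (proj₂ (∧-true⁻ (lookup C v) r″))

leastInCircuitWithin⁺ : ∀ {J : Oracle n} {S v} →
  LeastInCircuitWithin J S v → leastInCircuitWithin J S v ≡ true
leastInCircuitWithin⁺ {n} (C , c , C⊆S , least) = any-exhaustive⁺ (allSubsets-exhaustive n) _ C
  (∧-true⁺ (isCircuit⁺ _ c) (∧-true⁺ (⊆ᵇ⁺ C⊆S) (∧-true⁺ (∈⇒lookup (proj₁ least)) (isMinOf⁺ least))))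

extActive-∈ : ∀ (I : Oracle n) {B v} → v ∈ B → extActive I B v ≡ false
extActive-∈ I v∈B rewrite ∈⇒lookup v∈B = refl

intActive-∉ : ∀ (I : Oracle n) {B v} → v ∉ B → intActive I B v ≡ false
intActive-∉ I v∉B rewrite ∉⇒lookup v∉B = refl

data PunchInView {m : ℕ} (v : Fin (suc m)) : Fin (suc m) → Set where
  pivot   : PunchInView v v
  punched : ∀ j → PunchInView v (punchIn v j)

punchInView : ∀ {m} (v : Fin (suc m)) x → PunchInView v x
punchInView v x with v Fin.≟ x
... | yes refl = pivot
... | no  v≢x  = subst (PunchInView v) (Fin.punchIn-punchOut v≢x) (punched (punchOut v≢x))

-- lift v A and liftWith v A are the two subsets of [n] that restrict v maps to A.
liftWith : ∀ {m} → Fin (suc m) → Subset m → Subset (suc m)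
liftWith v A = lift v A ∪ ⁅ v ⁆

module _ {m : ℕ} (v : Fin (suc m)) where

  v∉lift : ∀ (A : Subset m) → v ∉ lift v A
  v∉lift A v∈A = true≢false (∈⇒lookup v∈A) (Vec.insertAt-lookup A v false)

  punchIn∈lift⁻ : ∀ {A : Subset m} {j} → punchIn v j ∈ lift v A → j ∈ A
  punchIn∈lift⁻ {A} {j} p = lookup⇒∈ (trans (sym (Vec.insertAt-punchIn A v false j)) (∈⇒lookup p))

  punchIn∈lift⁺ : ∀ {A : Subset m} {j} → j ∈ A → punchIn v j ∈ lift v A
  punchIn∈lift⁺ {A} {j} p = lookup⇒∈ (trans (Vec.insertAt-punchIn A v false j) (∈⇒lookup p))

  lookup-restrict : ∀ (A : Subset (suc m)) j → lookup (restrict v A) j ≡ lookup A (punchIn v j)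
  lookup-restrict A j =
    trans (cong (lookup (removeAt A v)) (sym (Fin.punchOut-punchIn v)))
          (Vec.removeAt-punchOut A (Fin.punchInᵢ≢i v j ∘ sym))

  ∈restrict⁻ : ∀ {A : Subset (suc m)} {j} → j ∈ restrict v A → punchIn v j ∈ A
  ∈restrict⁻ {A} {j} p = lookup⇒∈ (trans (sym (lookup-restrict A j)) (∈⇒lookup p))

  ∈restrict⁺ : ∀ {A : Subset (suc m)} {j} → punchIn v j ∈ A → j ∈ restrict v A
  ∈restrict⁺ {A} {j} p = lookup⇒∈ (trans (lookup-restrict A j) (∈⇒lookup p))

  lift-restrict : ∀ {A : Subset (suc m)} → v ∉ A → lift v (restrict v A) ≡ A
  lift-restrict {A} v∉A =
    subst (λ b → insertAt (removeAt A v) v b ≡ A) (∉⇒lookup v∉A) (Vec.insertAt-removeAt A v)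

  restrict-lift : ∀ (A : Subset m) → restrict v (lift v A) ≡ A
  restrict-lift A = Vec.removeAt-insertAt A v false

  lift-mono : ∀ {X Y : Subset m} → X ⊆ Y → lift v X ⊆ lift v Y
  lift-mono {X} X⊆Y {x} p with punchInView v x
  ... | pivot     = ⊥-elim (v∉lift X p)
  ... | punched j = punchIn∈lift⁺ (X⊆Y (punchIn∈lift⁻ p))

  restrict-mono : ∀ {X Y : Subset (suc m)} → X ⊆ Y → restrict v X ⊆ restrict v Y
  restrict-mono X⊆Y p = ∈restrict⁺ (X⊆Y (∈restrict⁻ p))

  v∈liftWith : ∀ A → v ∈ liftWith v A
  v∈liftWith A = Sub.q⊆p∪q (lift v A) ⁅ v ⁆ (Sub.x∈⁅x⁆ v)

  lift⊆liftWith : ∀ A → lift v A ⊆ liftWith v A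
  lift⊆liftWith A = Sub.p⊆p∪q ⁅ v ⁆

  liftWith-mono : ∀ {X Y : Subset m} → X ⊆ Y → liftWith v X ⊆ liftWith v Y
  liftWith-mono {X} X⊆Y p with Sub.x∈p∪q⁻ (lift v X) ⁅ v ⁆ p
  ... | inj₁ q = Sub.p⊆p∪q ⁅ v ⁆ (lift-mono X⊆Y q)
  ... | inj₂ q = Sub.q⊆p∪q _ ⁅ v ⁆ q

  punchIn∈liftWith⁻ : ∀ {A : Subset m} {j} → punchIn v j ∈ liftWith v A → j ∈ A
  punchIn∈liftWith⁻ {A} {j} p with Sub.x∈p∪q⁻ (lift v A) ⁅ v ⁆ p
  ... | inj₁ q = punchIn∈lift⁻ q
  ... | inj₂ q = ⊥-elim (Fin.punchInᵢ≢i v j (Sub.x∈⁅y⁆⇒x≡y v q))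

  restrict-liftWith : ∀ A → restrict v (liftWith v A) ≡ A
  restrict-liftWith A = Sub.⊆-antisym (punchIn∈liftWith⁻ ∘ ∈restrict⁻)
                                      (∈restrict⁺ ∘ lift⊆liftWith A ∘ punchIn∈lift⁺)

  liftWith-restrict : ∀ {A : Subset (suc m)} → v ∈ A → liftWith v (restrict v A) ≡ A
  liftWith-restrict {A} v∈A = Sub.⊆-antisym ⊆A A⊆
    where
    ⊆A : liftWith v (restrict v A) ⊆ A
    ⊆A {x} p with punchInView v x
    ... | pivot     = v∈A
    ... | punched j = ∈restrict⁻ (punchIn∈liftWith⁻ p)
    A⊆ : A ⊆ liftWith v (restrict v A)
    A⊆ {x} p with punchInView v x
    ... | pivot     = v∈liftWith _
    ... | punched j = lift⊆liftWith _ (punchIn∈lift⁺ (∈restrict⁺ p))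

  lift-∪⁅⁆ : ∀ (X : Subset m) j → lift v (X ∪ ⁅ j ⁆) ≡ lift v X ∪ ⁅ punchIn v j ⁆
  lift-∪⁅⁆ X j = Sub.⊆-antisym ⊆∪ ∪⊆
    where
    ⊆∪ : lift v (X ∪ ⁅ j ⁆) ⊆ lift v X ∪ ⁅ punchIn v j ⁆
    ⊆∪ {x} p with punchInView v x
    ... | pivot     = ⊥-elim (v∉lift _ p)
    ... | punched k with Sub.x∈p∪q⁻ X ⁅ j ⁆ (punchIn∈lift⁻ p)
    ...   | inj₁ q = Sub.p⊆p∪q _ (punchIn∈lift⁺ q)
    ...   | inj₂ q = Sub.q⊆p∪q _ _ (subst (λ z → punchIn v z ∈ ⁅ punchIn v j ⁆)
                                        (sym (Sub.x∈⁅y⁆⇒x≡y j q)) (Sub.x∈⁅x⁆ _))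
    ∪⊆ : lift v X ∪ ⁅ punchIn v j ⁆ ⊆ lift v (X ∪ ⁅ j ⁆)
    ∪⊆ p with Sub.x∈p∪q⁻ (lift v X) ⁅ punchIn v j ⁆ p
    ... | inj₁ q = lift-mono (Sub.p⊆p∪q ⁅ j ⁆) q
    ... | inj₂ q rewrite Sub.x∈⁅y⁆⇒x≡y (punchIn v j) q = punchIn∈lift⁺ (Sub.q⊆p∪q X _ (Sub.x∈⁅x⁆ j))

  restrict-⊆∪⁅punchIn⁆ : ∀ {X Y : Subset (suc m)} {i} →
    X ⊆ Y ∪ ⁅ punchIn v i ⁆ → restrict v X ⊆ restrict v Y ∪ ⁅ i ⁆
  restrict-⊆∪⁅punchIn⁆ {X} {Y} {i} X⊆ {j} p with Sub.x∈p∪q⁻ Y _ (X⊆ (∈restrict⁻ p))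
  ... | inj₁ q = Sub.p⊆p∪q ⁅ i ⁆ (∈restrict⁺ q)
  ... | inj₂ q rewrite Fin.punchIn-injective v j i (Sub.x∈⁅y⁆⇒x≡y _ q) = Sub.q⊆p∪q _ _ (Sub.x∈⁅x⁆ i)

  restrict-complement⊆ : ∀ (A : Subset (suc m)) → restrict v (complement A) ⊆ complement (restrict v A)
  restrict-complement⊆ A p = ∈complement⁺ (∈complement⁻ (∈restrict⁻ {complement A} p) ∘ ∈restrict⁻ {A})

  lift-complement-restrict : ∀ {B : Subset (suc m)} → v ∈ B →
    lift v (complement (restrict v B)) ≡ complement B
  lift-complement-restrict {B} v∈B = begin
    insertAt (complement (removeAt B v)) v false ≡⟨ cong (λ A → insertAt A v false) (complement≡∁ _) ⟩
    insertAt (∁ (removeAt B v)) v (not true)     ≡⟨ Vec.map-insertAt not true (removeAt B v) v ⟨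
    ∁ (insertAt (removeAt B v) v true)           ≡⟨ cong (∁ ∘ insertAt (removeAt B v) v) (∈⇒lookup v∈B) ⟨
    ∁ (insertAt (removeAt B v) v (lookup B v))   ≡⟨ cong ∁ (Vec.insertAt-removeAt B v) ⟩
    ∁ B                                          ≡⟨ complement≡∁ B ⟨
    complement B ∎
    where open ≡-Reasoning

-- Basis exchange

module MatroidProperties (M : Matroid n) where
  open Matroid M renaming (indep to I)

  hereditary : ∀ {A B} → A ⊆ B → I B ≡ true → I A ≡ true
  hereditary {A} {B} = indep-hereditary A B

  extend-within : ∀ {A K S} → I A ≡ true → A ⊆ S → I K ≡ true → K ⊆ S →
                  ∃[ T ] (I T ≡ true × A ⊆ T × T ⊆ S × ∣ K ∣ ≤ ∣ T ∣)
  extend-within {A} {K} {S} indA A⊆S indK K⊆S = go ∣ K ∣ (ℕ.m≤n+m ∣ K ∣ ∣ A ∣) indA A⊆S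
    where
    go : ∀ fuel {A} → ∣ K ∣ ≤ ∣ A ∣ + fuel → I A ≡ true → A ⊆ S →
         ∃[ T ] (I T ≡ true × A ⊆ T × T ⊆ S × ∣ K ∣ ≤ ∣ T ∣)
    go fuel {A} bound indA A⊆S with ∣ K ∣ ℕ.≤? ∣ A ∣
    ... | yes K≤A = A , indA , Sub.⊆-refl , A⊆S , K≤A
    go zero       bound indA A⊆S | no K≰A = ⊥-elim (K≰A (subst (∣ K ∣ ≤_) (ℕ.+-identityʳ _) bound))
    go (suc fuel) {A} bound indA A⊆S | no K≰A with indep-augment A K indA indK (ℕ.≰⇒> K≰A)
    ... | e , e∈K , e∉A , indAe with go fuel bound′ indAe Ae⊆S
      where
      bound′ : ∣ K ∣ ≤ ∣ A ∪ ⁅ e ⁆ ∣ + fuel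
      bound′ = ℕ.≤-trans bound (ℕ.≤-trans (ℕ.≤-reflexive (ℕ.+-suc ∣ A ∣ fuel))
                                          (ℕ.+-monoˡ-≤ fuel (∣p∣<∣p∪⁅x⁆∣ A e∉A)))
      Ae⊆S : A ∪ ⁅ e ⁆ ⊆ S
      Ae⊆S p with Sub.x∈p∪q⁻ A ⁅ e ⁆ p
      ... | inj₁ q = A⊆S q
      ... | inj₂ q rewrite Sub.x∈⁅y⁆⇒x≡y e q = K⊆S e∈K
    ... | T , indT , Ae⊆T , T⊆S , K≤T = T , indT , Ae⊆T ∘ Sub.p⊆p∪q ⁅ e ⁆ , T⊆S , K≤T

  basis-unaugmentable : ∀ {W T} → IsBasis I W → I T ≡ true → ¬ (∣ W ∣ < ∣ T ∣)
  basis-unaugmentable {W} {T} b indT W<T with indep-augment W T (IsBasis.independent b) indT W<T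
  ... | e , _ , e∉W , indWe =
    e∉W (subst (e ∈_) (IsBasis.maximal b (W ∪ ⁅ e ⁆) (Sub.p⊆p∪q ⁅ e ⁆) indWe) (Sub.q⊆p∪q W _ (Sub.x∈⁅x⁆ e)))

  ∣indep∣≤∣basis∣ : ∀ {W T} → IsBasis I W → I T ≡ true → ∣ T ∣ ≤ ∣ W ∣
  ∣indep∣≤∣basis∣ b indT = ℕ.≮⇒≥ (basis-unaugmentable b indT)

  large-indep-isBasis : ∀ {W T} → IsBasis I W → I T ≡ true → ∣ W ∣ ≤ ∣ T ∣ → IsBasis I T
  large-indep-isBasis {W} {T} b indT W≤T = record { independent = indT ; maximal = maximal }
    where
    maximal : ∀ A → T ⊆ A → I A ≡ true → A ≡ T
    maximal A T⊆A indA with Vec.≡-dec _≟_ A T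
    ... | yes A≡T = A≡T
    ... | no  A≢T = ⊥-elim (basis-unaugmentable b indA
                             (ℕ.≤-<-trans W≤T (Sub.p⊂q⇒∣p∣<∣q∣ (⊆∧≢⇒⊂ T⊆A (A≢T ∘ sym)))))

  basis-through : ∀ {W v} → IsBasis I W → I ⁅ v ⁆ ≡ true → ∃[ T ] (IsBasis I T × v ∈ T × T ⊆ W ∪ ⁅ v ⁆)
  basis-through {W} {v} b indv
    with extend-within indv (Sub.q⊆p∪q W ⁅ v ⁆) (IsBasis.independent b) (Sub.p⊆p∪q ⁅ v ⁆)
  ... | T , indT , v⊆T , T⊆ , W≤T = T , large-indep-isBasis b indT W≤T , v⊆T (Sub.x∈⁅x⁆ v) , T⊆

  fundamental-circuit-exchange : ∀ {B C e y Z} → IsBasis I B → IsCircuit I C → C ⊆ B ∪ ⁅ e ⁆ →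
    y ∈ C → Z ⊆ B ∪ ⁅ e ⁆ → y ∉ Z → I Z ≡ true
  fundamental-circuit-exchange {B} {C} {e} {y} {Z} b c C⊆ y∈C Z⊆ y∉Z with y ∈? B
  ... | no y∉B = hereditary Z⊆B (IsBasis.independent b)
    where
    Z⊆B : Z ⊆ B
    Z⊆B z∈Z with Sub.x∈p∪q⁻ B ⁅ e ⁆ (Z⊆ z∈Z) | Sub.x∈p∪q⁻ B ⁅ e ⁆ (C⊆ y∈C)
    ... | inj₁ z∈B | _        = z∈B
    ... | inj₂ _   | inj₁ y∈B = ⊥-elim (y∉B y∈B)
    ... | inj₂ z≡e | inj₂ y≡e rewrite Sub.x∈⁅y⁆⇒x≡y e z≡e | Sub.x∈⁅y⁆⇒x≡y e y≡e = ⊥-elim (y∉Z z∈Z)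
  ... | yes y∈B with extend-within indC-y (C⊆ ∘ proj₁ ∘ x∈p-y⁻) (IsBasis.independent b) (Sub.p⊆p∪q ⁅ e ⁆)
    where
    indC-y : I (C - y) ≡ true
    indC-y = IsCircuit.minimal c (C - y) (proj₁ ∘ x∈p-y⁻)
               (λ C-y≡C → proj₂ (x∈p-y⁻ (subst (y ∈_) (sym C-y≡C) y∈C)) refl)
  ... | T , indT , C-y⊆T , T⊆ , B≤T = hereditary Z⊆T indT
    where
    y∉T : y ∉ T
    y∉T y∈T = true≢false (hereditary C⊆T indT) (IsCircuit.dependent c)
      where
      C⊆T : C ⊆ T
      C⊆T {x} x∈C with x Fin.≟ y
      ... | yes refl = y∈T
      ... | no  x≢y  = C-y⊆T (Sub.x∈p∧x≢y⇒x∈p-y x∈C x≢y)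
    exchanged : ∀ {w} → w ∈ B ∪ ⁅ e ⁆ → w ≢ y → w ∈ (B - y) ∪ ⁅ e ⁆
    exchanged {w} p w≢y with Sub.x∈p∪q⁻ B ⁅ e ⁆ p
    ... | inj₁ q = Sub.p⊆p∪q ⁅ e ⁆ (Sub.x∈p∧x≢y⇒x∈p-y q w≢y)
    ... | inj₂ q = Sub.q⊆p∪q (B - y) _ q
    -- (B - y) ∪ {e} contains T and has at most ∣ B ∣ ≤ ∣ T ∣ elements, so it is T.
    ∣B-y+e∣≤∣T∣ : ∣ (B - y) ∪ ⁅ e ⁆ ∣ ≤ ∣ T ∣
    ∣B-y+e∣≤∣T∣ = begin
      ∣ (B - y) ∪ ⁅ e ⁆ ∣ ≤⟨ ∣p∪⁅x⁆∣≤1+∣p∣ (B - y) e ⟩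
      suc ∣ B - y ∣       ≤⟨ Sub.x∈p⇒∣p-x∣<∣p∣ y∈B ⟩
      ∣ B ∣               ≤⟨ B≤T ⟩
      ∣ T ∣               ∎
      where open ℕ.≤-Reasoning
    Z⊆T : Z ⊆ T
    Z⊆T z∈Z = p⊆q∧∣q∣≤∣p∣⇒q⊆p (λ w∈T → exchanged (T⊆ w∈T) λ { refl → y∉T w∈T }) ∣B-y+e∣≤∣T∣
                (exchanged (Z⊆ z∈Z) λ { refl → y∉Z z∈Z })

  exchange-isBasis : ∀ {B e f} → IsBasis I B → e ∈ B → f ∉ B - e → I ((B - e) ∪ ⁅ f ⁆) ≡ true →
    IsBasis I ((B - e) ∪ ⁅ f ⁆)
  exchange-isBasis {B} {e} b e∈B f∉B-e indW =
    large-indep-isBasis b indW (ℕ.≤-trans (∣p∣≤1+∣p-x∣ e∈B) (∣p∣<∣p∪⁅x⁆∣ (B - e) f∉B-e))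

  fundamental-cocircuit-exchange : ∀ {B D e y} → IsBasis I B → IsCircuit (dual I) D →
    D ⊆ complement B ∪ ⁅ e ⁆ → e ∈ B → y ∈ D → IsBasis I ((B - e) ∪ ⁅ y ⁆)
  fundamental-cocircuit-exchange {B} {D} {e} {y} b d D⊆ e∈B y∈D with y Fin.≟ e
  ... | yes refl = subst (IsBasis I) (sym (p-x∪⁅x⁆≡p e∈B)) b
  ... | no y≢e with dual⁻ I (IsCircuit.minimal d (D - y) (proj₁ ∘ x∈p-y⁻)
                   (λ D-y≡D → proj₂ (x∈p-y⁻ (subst (y ∈_) (sym D-y≡D) y∈D)) refl))
  ... | B′ , b′ , D-y#B′
    with indep-augment (B - e) B′ (hereditary (proj₁ ∘ x∈p-y⁻) (IsBasis.independent b))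
           (IsBasis.independent b′)
           (ℕ.<-≤-trans (Sub.x∈p⇒∣p-x∣<∣p∣ e∈B) (∣indep∣≤∣basis∣ b′ (IsBasis.independent b)))
  ... | f , f∈B′ , f∉B-e , indW with f Fin.≟ y
  ...   | yes refl = exchange-isBasis b e∈B f∉B-e indW
  ...   | no f≢y with f ∈? D
  ...     | yes f∈D = ⊥-elim (D-y#B′ (Sub.x∈p∧x≢y⇒x∈p-y f∈D f≢y) f∈B′)
  ...     | no  f∉D =
    ⊥-elim (true≢false (dual⁺ I (exchange-isBasis b e∈B f∉B-e indW) D#W) (IsCircuit.dependent d))
    where
    D#W : Disjoint D ((B - e) ∪ ⁅ f ⁆)
    D#W {x} x∈D x∈W with Sub.x∈p∪q⁻ (B - e) ⁅ f ⁆ x∈W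
    ... | inj₂ x≡f rewrite Sub.x∈⁅y⁆⇒x≡y f x≡f = f∉D x∈D
    ... | inj₁ x∈B-e with x∈p-y⁻ x∈B-e | Sub.x∈p∪q⁻ (complement B) ⁅ e ⁆ (D⊆ x∈D)
    ...   | x∈B , _   | inj₁ x∉B = ∈complement⁻ x∉B x∈B
    ...   | _   , x≢e | inj₂ x≡e = x≢e (Sub.x∈⁅y⁆⇒x≡y e x≡e)

-- Minors

module _ {m : ℕ} (v : Fin (suc m)) {J : Oracle (suc m)} {J′ : Oracle m} where

  module _ (J′≗J∘lift : ∀ A → J′ A ≡ J (lift v A)) where

    IsCircuit-lift⁺ : ∀ {D} → IsCircuit J′ D → IsCircuit J (lift v D)
    IsCircuit-lift⁺ {D} c = record
      { dependent = trans (sym (J′≗J∘lift D)) (IsCircuit.dependent c)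
      ; minimal   = minimal
      }
      where
      minimal : ∀ X → X ⊆ lift v D → X ≢ lift v D → J X ≡ true
      minimal X X⊆ X≢ = subst (λ Y → J Y ≡ true) lift-restrict-X (trans (sym (J′≗J∘lift _))
        (IsCircuit.minimal c (restrict v X) (subst (restrict v X ⊆_) (restrict-lift v D) (restrict-mono v X⊆))
          (λ X′≡D → X≢ (trans (sym lift-restrict-X) (cong (lift v) X′≡D)))))
        where
        lift-restrict-X : lift v (restrict v X) ≡ X
        lift-restrict-X = lift-restrict v (v∉lift v D ∘ X⊆)

    IsCircuit-lift⁻ : ∀ {D} → IsCircuit J (lift v D) → IsCircuit J′ D
    IsCircuit-lift⁻ {D} c = record
      { dependent = trans (J′≗J∘lift D) (IsCircuit.dependent c)
      ; minimal   = λ X X⊆D X≢D → trans (J′≗J∘lift X) (IsCircuit.minimal c (lift v X) (lift-mono v X⊆D)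
          (λ lX≡lD → X≢D (trans (sym (restrict-lift v X))
                               (trans (cong (restrict v) lX≡lD) (restrict-lift v D)))))
      }

  module _ (J′≗J∘liftWith : ∀ A → J′ A ≡ J (liftWith v A)) where

    IsBasis-liftWith⁺ : ∀ {X} → IsBasis J′ X → IsBasis J (liftWith v X)
    IsBasis-liftWith⁺ {X} b = record
      { independent = trans (sym (J′≗J∘liftWith X)) (IsBasis.independent b)
      ; maximal     = maximal
      }
      where
      maximal : ∀ A → liftWith v X ⊆ A → J A ≡ true → A ≡ liftWith v X
      maximal A X⊆A indA = trans (sym (liftWith-restrict v v∈A)) (cong (liftWith v) restrict-A≡X)
        where
        v∈A = X⊆A (v∈liftWith v X)
        restrict-A≡X : restrict v A ≡ X
        restrict-A≡X = IsBasis.maximal b (restrict v A)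
          (restrict-mono v X⊆A ∘ ∈restrict⁺ v ∘ lift⊆liftWith v X ∘ punchIn∈lift⁺ v)
          (trans (J′≗J∘liftWith _) (subst (λ Y → J Y ≡ true) (sym (liftWith-restrict v v∈A)) indA))

    IsBasis-liftWith⁻ : ∀ {X} → IsBasis J (liftWith v X) → IsBasis J′ X
    IsBasis-liftWith⁻ {X} b = record
      { independent = trans (J′≗J∘liftWith X) (IsBasis.independent b)
      ; maximal     = λ A X⊆A indA → trans (sym (restrict-liftWith v A))
          (trans (cong (restrict v) (IsBasis.maximal b (liftWith v A) (liftWith-mono v X⊆A)
                                      (trans (sym (J′≗J∘liftWith A)) indA)))
                 (restrict-liftWith v X))
      }

module Minors {m : ℕ} (M : Matroid (suc m)) (v : Fin (suc m)) where
  open Matroid M renaming (indep to I)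
  open MatroidProperties M

  contractO-nonloop : I ⁅ v ⁆ ≡ true → ∀ A → contractO I v A ≡ I (liftWith v A)
  contractO-nonloop indv A rewrite indv = refl

  dual-contractO : I ⁅ v ⁆ ≡ true → ∀ A → dual (contractO I v) A ≡ dual I (lift v A)
  dual-contractO indv A = ⇔→≡ {z = true} (mk⇔ to from)
    where
    to : dual (contractO I v) A ≡ true → dual I (lift v A) ≡ true
    to h with dual⁻ (contractO I v) h
    ... | B′ , b′ , A#B′ = dual⁺ I (IsBasis-liftWith⁺ v (contractO-nonloop indv) b′) lA#
      where
      lA# : Disjoint (lift v A) (liftWith v B′)
      lA# {x} p q with punchInView v x
      ... | pivot     = v∉lift v A p
      ... | punched j = A#B′ (punchIn∈lift⁻ v p) (punchIn∈liftWith⁻ v q)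
    from : dual I (lift v A) ≡ true → dual (contractO I v) A ≡ true
    from h with dual⁻ I h
    ... | W , w , lA#W with basis-through w indv
    ... | T , t , v∈T , T⊆ = dual⁺ (contractO I v)
            (IsBasis-liftWith⁻ v (contractO-nonloop indv)
              (subst (IsBasis I) (sym (liftWith-restrict v v∈T)) t))
            A#
      where
      A# : Disjoint A (restrict v T)
      A# {j} p q with Sub.x∈p∪q⁻ W ⁅ v ⁆ (T⊆ (∈restrict⁻ v q))
      ... | inj₁ r = lA#W (punchIn∈lift⁺ v p) r
      ... | inj₂ r = Fin.punchInᵢ≢i v j (Sub.x∈⁅y⁆⇒x≡y v r)

  restrict-isBasis : ∀ {W} → IsBasis I W → v ∉ W → IsBasis (deleteO I v) (restrict v W)
  restrict-isBasis {W} w v∉W = record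
    { independent = subst (λ Y → I Y ≡ true) (sym (lift-restrict v v∉W)) (IsBasis.independent w)
    ; maximal     = λ A W⊆A indA → trans (sym (restrict-lift v A))
        (cong (restrict v) (IsBasis.maximal w (lift v A) (W⊆lift W⊆A) indA))
    }
    where
    W⊆lift : ∀ {A} → restrict v W ⊆ A → W ⊆ lift v A
    W⊆lift W⊆A {x} p with punchInView v x
    ... | pivot     = ⊥-elim (v∉W p)
    ... | punched j = punchIn∈lift⁺ v (W⊆A (∈restrict⁺ v p))

  lift-isBasis : ∀ {B B′} → IsBasis I B → v ∉ B → IsBasis (deleteO I v) B′ → IsBasis I (lift v B′)
  lift-isBasis {B} {B′} b v∉B b′ = large-indep-isBasis b (IsBasis.independent b′) (ℕ.≮⇒≥ unaugmentable)
    where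
    unaugmentable : ¬ (∣ lift v B′ ∣ < ∣ B ∣)
    unaugmentable B′<B with indep-augment (lift v B′) B (IsBasis.independent b′) (IsBasis.independent b) B′<B
    ... | x , x∈B , x∉B′ , indB′x with punchInView v x
    ...   | pivot     = v∉B x∈B
    ...   | punched j = x∉B′ (punchIn∈lift⁺ v j∈B′)
      where
      j∈B′ : j ∈ B′
      j∈B′ = subst (j ∈_) (IsBasis.maximal b′ (B′ ∪ ⁅ j ⁆) (Sub.p⊆p∪q ⁅ j ⁆)
                             (subst (λ Y → I Y ≡ true) (sym (lift-∪⁅⁆ v B′ j)) indB′x))
                   (Sub.q⊆p∪q B′ _ (Sub.x∈⁅x⁆ j))

-- Activities in minors

module _ {m : ℕ} (v : Fin (suc m)) where

  IsLeast-lift : ∀ {i D} → IsLeast i D → IsLeast (punchIn v i) (lift v D)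
  IsLeast-lift {i} {D} (i∈D , least) = punchIn∈lift⁺ v i∈D , least′
    where
    least′ : ∀ e → e ∈ lift v D → toℕ (punchIn v i) ≤ toℕ e
    least′ e p with punchInView v e
    ... | pivot     = ⊥-elim (v∉lift v D p)
    ... | punched j = Fin.punchIn-mono-≤ v i j (least j (punchIn∈lift⁻ v p))

  IsLeast-restrict : ∀ {i D} → IsLeast (punchIn v i) D → IsLeast i (restrict v D)
  IsLeast-restrict {i} (i∈D , least) =
    ∈restrict⁺ v i∈D , λ j p → Fin.punchIn-cancel-≤ v i j (least _ (∈restrict⁻ v p))

  leastInCircuitWithin-lift : ∀ {J : Oracle (suc m)} {J′ : Oracle m} → (∀ A → J′ A ≡ J (lift v A)) →
    ∀ S i → leastInCircuitWithin J′ S i ≡ leastInCircuitWithin J (lift v S) (punchIn v i)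
  leastInCircuitWithin-lift {J} {J′} J′≗J∘lift S i = ⇔→≡ {z = true} (mk⇔
    (leastInCircuitWithin⁺ ∘ to ∘ leastInCircuitWithin⁻)
    (leastInCircuitWithin⁺ ∘ from ∘ leastInCircuitWithin⁻))
    where
    to : LeastInCircuitWithin J′ S i → LeastInCircuitWithin J (lift v S) (punchIn v i)
    to (C , c , C⊆S , least) = lift v C , IsCircuit-lift⁺ v J′≗J∘lift c , lift-mono v C⊆S , IsLeast-lift least
    from : LeastInCircuitWithin J (lift v S) (punchIn v i) → LeastInCircuitWithin J′ S i
    from (C , c , C⊆S , least) =
      restrict v C ,
      IsCircuit-lift⁻ v J′≗J∘lift (subst (IsCircuit J) (sym (lift-restrict v (v∉lift v S ∘ C⊆S))) c) ,
      punchIn∈lift⁻ v ∘ C⊆S ∘ ∈restrict⁻ v ,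
      IsLeast-restrict least

module Activity {m : ℕ} (M : Matroid (suc m)) {B : Subset (suc m)} (b : IsBasis (Matroid.indep M) B)
                (v : Fin (suc m)) where
  open Matroid M renaming (indep to I)
  open MatroidProperties M
  open Minors M v

  module _ (v∈B : v ∈ B) where

    nonloop : I ⁅ v ⁆ ≡ true
    nonloop = hereditary (λ p → subst (_∈ B) (sym (Sub.x∈⁅y⁆⇒x≡y v p)) v∈B) (IsBasis.independent b)

    intActive-contractO : ∀ i → intActive I B (punchIn v i) ≡ intActive (contractO I v) (restrict v B) i
    intActive-contractO i = sym (cong₂ _∧_ (lookup-restrict v B i) (begin
      leastInCircuitWithin (dual (contractO I v)) (complement (restrict v B) ∪ ⁅ i ⁆) i
        ≡⟨ leastInCircuitWithin-lift v {J = dual I} (dual-contractO nonloop) _ i ⟩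
      leastInCircuitWithin (dual I) (lift v (complement (restrict v B) ∪ ⁅ i ⁆)) (punchIn v i)
        ≡⟨ cong (λ S → leastInCircuitWithin (dual I) S (punchIn v i)) lift-S ⟩
      leastInCircuitWithin (dual I) (complement B ∪ ⁅ punchIn v i ⁆) (punchIn v i) ∎))
      where
      open ≡-Reasoning
      lift-S : lift v (complement (restrict v B) ∪ ⁅ i ⁆) ≡ complement B ∪ ⁅ punchIn v i ⁆
      lift-S = trans (lift-∪⁅⁆ v _ i) (cong (_∪ ⁅ punchIn v i ⁆) (lift-complement-restrict v v∈B))

    restrict-circuit-contractO : ∀ {C i} → IsCircuit I C → C ⊆ B ∪ ⁅ punchIn v i ⁆ →
      IsCircuit (contractO I v) (restrict v C)
    restrict-circuit-contractO {C} {i} c C⊆ = record { dependent = dependent ; minimal = minimal }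
      where
      C⊆liftWith : C ⊆ liftWith v (restrict v C)
      C⊆liftWith {x} p with punchInView v x
      ... | pivot     = v∈liftWith v _
      ... | punched j = lift⊆liftWith v _ (punchIn∈lift⁺ v (∈restrict⁺ v p))
      dependent : contractO I v (restrict v C) ≡ false
      dependent = trans (contractO-nonloop nonloop _)
                        (¬-not λ ind → true≢false (hereditary C⊆liftWith ind) (IsCircuit.dependent c))
      minimal : ∀ X → X ⊆ restrict v C → X ≢ restrict v C → contractO I v X ≡ true
      minimal X X⊆ X≢ with ⊆∧≢⇒⊂ X⊆ X≢
      ... | _ , y , y∈C , y∉X = trans (contractO-nonloop nonloop X)
            (fundamental-circuit-exchange b c C⊆ (∈restrict⁻ v y∈C) liftWith-X⊆ (y∉X ∘ punchIn∈liftWith⁻ v))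
        where
        liftWith-X⊆ : liftWith v X ⊆ B ∪ ⁅ punchIn v i ⁆
        liftWith-X⊆ {x} p with punchInView v x
        ... | pivot     = Sub.p⊆p∪q _ v∈B
        ... | punched j = C⊆ (∈restrict⁻ v (X⊆ (punchIn∈liftWith⁻ v p)))

    extActive-contractO : ∀ i → extActive I B (punchIn v i) ≡ true →
      extActive (contractO I v) (restrict v B) i ≡ true
    extActive-contractO i h with ∧-true⁻ (not (lookup B (punchIn v i))) h
    ... | i∉B , w with leastInCircuitWithin⁻ w
    ... | C , c , C⊆ , least = ∧-true⁺ (trans (cong not (lookup-restrict v B i)) i∉B)
      (leastInCircuitWithin⁺ (restrict v C , restrict-circuit-contractO c C⊆ ,
                              restrict-⊆∪⁅punchIn⁆ v C⊆ , IsLeast-restrict v least))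

  module _ (v∉B : v ∉ B) where

    extActive-deleteO : ∀ i → extActive I B (punchIn v i) ≡ extActive (deleteO I v) (restrict v B) i
    extActive-deleteO i = sym (cong₂ (λ x y → not x ∧ y) (lookup-restrict v B i) (begin
      leastInCircuitWithin (deleteO I v) (restrict v B ∪ ⁅ i ⁆) i
        ≡⟨ leastInCircuitWithin-lift v {J = I} {deleteO I v} (λ _ → refl) _ i ⟩
      leastInCircuitWithin I (lift v (restrict v B ∪ ⁅ i ⁆)) (punchIn v i)
        ≡⟨ cong (λ S → leastInCircuitWithin I S (punchIn v i)) lift-S ⟩
      leastInCircuitWithin I (B ∪ ⁅ punchIn v i ⁆) (punchIn v i) ∎))
      where
      open ≡-Reasoning
      lift-S : lift v (restrict v B ∪ ⁅ i ⁆) ≡ B ∪ ⁅ punchIn v i ⁆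
      lift-S = trans (lift-∪⁅⁆ v _ i) (cong (_∪ ⁅ punchIn v i ⁆) (lift-restrict v v∉B))

    restrict-cocircuit-deleteO : ∀ {D i} → IsCircuit (dual I) D → D ⊆ complement B ∪ ⁅ punchIn v i ⁆ →
      punchIn v i ∈ B → IsCircuit (dual (deleteO I v)) (restrict v D)
    restrict-cocircuit-deleteO {D} {i} d D⊆ e∈B =
      record { dependent = ¬-not coindependent⇒⊥ ; minimal = minimal }
      where
      D∩B⊆e : ∀ {x} → x ∈ D → x ∈ B → x ≡ punchIn v i
      D∩B⊆e x∈D x∈B with Sub.x∈p∪q⁻ (complement B) _ (D⊆ x∈D)
      ... | inj₁ x∉B = ⊥-elim (∈complement⁻ x∉B x∈B)
      ... | inj₂ x≡e = Sub.x∈⁅y⁆⇒x≡y _ x≡e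
      coindependent⇒⊥ : dual (deleteO I v) (restrict v D) ≢ true
      coindependent⇒⊥ h with dual⁻ (deleteO I v) h
      ... | B′ , b′ , D#B′ = true≢false (dual⁺ I (lift-isBasis b v∉B b′) D#lB′) (IsCircuit.dependent d)
        where
        D#lB′ : Disjoint D (lift v B′)
        D#lB′ {x} p q with punchInView v x
        ... | pivot     = v∉lift v B′ q
        ... | punched j = D#B′ (∈restrict⁺ v p) (punchIn∈lift⁻ v q)
      minimal : ∀ X → X ⊆ restrict v D → X ≢ restrict v D → dual (deleteO I v) X ≡ true
      minimal X X⊆ X≢ with ⊆∧≢⇒⊂ X⊆ X≢
      ... | _ , y , y∈D , y∉X = dual⁺ (deleteO I v)
            (restrict-isBasis (fundamental-cocircuit-exchange b d D⊆ e∈B (∈restrict⁻ v y∈D)) v∉W) X#W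
        where
        W = (B - punchIn v i) ∪ ⁅ punchIn v y ⁆
        v∉W : v ∉ W
        v∉W p with Sub.x∈p∪q⁻ (B - punchIn v i) _ p
        ... | inj₁ q = v∉B (proj₁ (x∈p-y⁻ q))
        ... | inj₂ q = Fin.punchInᵢ≢i v y (sym (Sub.x∈⁅y⁆⇒x≡y _ q))
        X#W : Disjoint X (restrict v W)
        X#W {j} p q with Sub.x∈p∪q⁻ (B - punchIn v i) _ (∈restrict⁻ v q)
        ... | inj₁ r = let j∈B , j≢e = x∈p-y⁻ r in j≢e (D∩B⊆e (∈restrict⁻ v (X⊆ p)) j∈B)
        ... | inj₂ r = y∉X (subst (_∈ X) (Fin.punchIn-injective v j y (Sub.x∈⁅y⁆⇒x≡y _ r)) p)

    intActive-deleteO : ∀ i → intActive I B (punchIn v i) ≡ true →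
      intActive (deleteO I v) (restrict v B) i ≡ true
    intActive-deleteO i h with ∧-true⁻ (lookup B (punchIn v i)) h
    ... | i∈B , w with leastInCircuitWithin⁻ w
    ... | D , d , D⊆ , least = ∧-true⁺ (trans (lookup-restrict v B i) i∈B)
      (leastInCircuitWithin⁺ (restrict v D , restrict-cocircuit-deleteO d D⊆ (lookup⇒∈ i∈B) ,
                              D′⊆ , IsLeast-restrict v least))
      where
      D′⊆ : restrict v D ⊆ complement (restrict v B) ∪ ⁅ i ⁆
      D′⊆ p with Sub.x∈p∪q⁻ (restrict v (complement B)) ⁅ i ⁆ (restrict-⊆∪⁅punchIn⁆ v D⊆ p)
      ... | inj₁ q = Sub.p⊆p∪q ⁅ i ⁆ (restrict-complement⊆ v B q)
      ... | inj₂ q = Sub.q⊆p∪q _ ⁅ i ⁆ q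

-- Counting active elements

indicator : Bool → ℕ
indicator b = if b then 1 else 0

countᵇ-map : ∀ {A B : Set} (p : B → Bool) (f : A → B) xs → countᵇ p (List.map f xs) ≡ countᵇ (p ∘ f) xs
countᵇ-map p f List.[]        = refl
countᵇ-map p f (x List.∷ xs) = cong (indicator (p (f x)) +_) (countᵇ-map p f xs)

countᵇ-cong : ∀ {A : Set} {p q : A → Bool} → (∀ x → p x ≡ q x) → ∀ xs → countᵇ p xs ≡ countᵇ q xs
countᵇ-cong p≗q List.[]        = refl
countᵇ-cong p≗q (x List.∷ xs) = cong₂ (λ b c → indicator b + c) (p≗q x) (countᵇ-cong p≗q xs)

countᵇ-mono : ∀ {A : Set} {p q : A → Bool} → (∀ x → p x ≡ true → q x ≡ true) →
  ∀ xs → countᵇ p xs ≤ countᵇ q xs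
countᵇ-mono p⇒q List.[] = z≤n
countᵇ-mono {p = p} {q} p⇒q (x List.∷ xs) with p x in px
... | true  rewrite p⇒q x px = s≤s (countᵇ-mono p⇒q xs)
... | false = ℕ.≤-trans (countᵇ-mono p⇒q xs) (ℕ.m≤n+m _ (indicator (q x)))

countᵇ-allFinL-punchIn : ∀ {m} (p : Fin (suc m) → Bool) v →
  countᵇ p (allFinL (suc m)) ≡ indicator (p v) + countᵇ (p ∘ punchIn v) (allFinL m)
countᵇ-allFinL-punchIn {m} p Fin.zero = cong (indicator (p Fin.zero) +_) (countᵇ-map p Fin.suc (allFinL m))
countᵇ-allFinL-punchIn {suc m} p (Fin.suc w) = begin
  indicator p₀ + countᵇ p (List.map Fin.suc (allFinL (suc m)))
    ≡⟨ cong (indicator p₀ +_) (countᵇ-map p Fin.suc (allFinL (suc m))) ⟩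
  indicator p₀ + countᵇ (p ∘ Fin.suc) (allFinL (suc m))
    ≡⟨ cong (indicator p₀ +_) (countᵇ-allFinL-punchIn (p ∘ Fin.suc) w) ⟩
  indicator p₀ + (indicator (p (Fin.suc w)) + countᵇ (p ∘ Fin.suc ∘ punchIn w) (allFinL m))
    ≡⟨ x∙yz≈y∙xz (indicator p₀) (indicator (p (Fin.suc w))) _ ⟩
  indicator (p (Fin.suc w)) + (indicator p₀ + countᵇ (p ∘ punchIn (Fin.suc w) ∘ Fin.suc) (allFinL m))
    ≡⟨ cong (λ c → indicator (p (Fin.suc w)) + (indicator p₀ + c))
            (countᵇ-map (p ∘ punchIn (Fin.suc w)) Fin.suc (allFinL m)) ⟨
  indicator (p (Fin.suc w)) + countᵇ (p ∘ punchIn (Fin.suc w)) (allFinL (suc m)) ∎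
  where
  open ≡-Reasoning
  p₀ = p Fin.zero

countᵇ-punchIn-≡ : ∀ {m} {p : Fin (suc m) → Bool} {q : Fin m → Bool} v → p v ≡ false →
  (∀ i → p (punchIn v i) ≡ q i) → countᵇ p (allFinL (suc m)) ≡ countᵇ q (allFinL m)
countᵇ-punchIn-≡ {m} {p} v pv≡false agree =
  trans (countᵇ-allFinL-punchIn p v)
        (cong₂ (λ b c → indicator b + c) pv≡false (countᵇ-cong agree (allFinL m)))

countᵇ-punchIn-≤ : ∀ {m} {p : Fin (suc m) → Bool} {q : Fin m → Bool} v → p v ≡ false →
  (∀ i → p (punchIn v i) ≡ true → q i ≡ true) → countᵇ p (allFinL (suc m)) ≤ countᵇ q (allFinL m)
countᵇ-punchIn-≤ {m} {p} {q} v pv≡false p⇒q = begin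
  countᵇ p (allFinL (suc m))
    ≡⟨ countᵇ-allFinL-punchIn p v ⟩
  indicator (p v) + countᵇ (p ∘ punchIn v) (allFinL m)
    ≡⟨ cong (λ b → indicator b + countᵇ (p ∘ punchIn v) (allFinL m)) pv≡false ⟩
  countᵇ (p ∘ punchIn v) (allFinL m)
    ≤⟨ countᵇ-mono p⇒q (allFinL m) ⟩
  countᵇ q (allFinL m) ∎
  where open ℕ.≤-Reasoning

lemma3p3 : ∀ {m : ℕ} (M : Matroid (suc m)) (B : Subset (suc m)) →
    isBasis (Matroid.indep M) B ≡ true → (v : Fin (suc m)) →
    (v ∈ B → intActive (Matroid.indep M) B v ≡ false →
      (int (Matroid.indep M) B ≡ int (contractO (Matroid.indep M) v) (restrict v B))
      × (ext (Matroid.indep M) B ≤ ext (contractO (Matroid.indep M) v) (restrict v B)))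
    × (v ∉ B → extActive (Matroid.indep M) B v ≡ false →
      (int (Matroid.indep M) B ≤ int (deleteO (Matroid.indep M) v) (restrict v B))
      × (ext (Matroid.indep M) B ≡ ext (deleteO (Matroid.indep M) v) (restrict v B)))
lemma3p3 {m} M B isB v =
    (λ v∈B inactive → countᵇ-punchIn-≡ v inactive (intActive-contractO v∈B)
                    , countᵇ-punchIn-≤ v (extActive-∈ I v∈B) (extActive-contractO v∈B))
  , (λ v∉B inactive → countᵇ-punchIn-≤ v (intActive-∉ I v∉B) (intActive-deleteO v∉B)
                    , countᵇ-punchIn-≡ v inactive (extActive-deleteO v∉B))
  where
  I : Oracle (suc m)
  I = Matroid.indep M
  open Activity M (isBasis⁻ I isB) v
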